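{- The confining cop number of every connected cograph on fewer than $8$ vertices is equal to $1$. Moreover, for every $n\ge 8$ there is a connected cograph $G$ on $n$ vertices such that $ccn(G)=2$.
   Context: A cograph is a graph with no induced path on $4$ vertices. Game of Cops and Robbers: cops choose vertices first, then the robber; players alternate, each moving to an adjacent vertex or staying; capture when a cop occupies the robber's vertex. The robber is confined if it has to stay at its current vertex in order to avoid capture in the next move of the cops. $ccn(G)$, the confining cop number, is the minimum number of cops that can force confinement (or capture) of the robber. -}

module Defs where

open import Data.Nat using (ℕ; _≤_; _<_)
open import Data.Fin using (Fin)
open import Data.Bool using (Bool; true; false)
open import Data.Product using (Σ; ∃; _×_; _,_)
open import Data.Sum using (_⊎_)
open import Relation.Nullary using (¬_)
open import Relation.Binary.PropositionalEquality using (_≡_; _≢_)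

record Graph (n : ℕ) : Set where
  field
    E     : Fin n → Fin n → Bool
    sym   : ∀ u v → E u v ≡ E v u
    irrefl : ∀ u → E u u ≡ false

module _ {n : ℕ} (G : Graph n) where
  open Graph G

  Adj : Fin n → Fin n → Set
  Adj u v = E u v ≡ true

  NonAdj : Fin n → Fin n → Set
  NonAdj u v = E u v ≡ false

  ClosedAdj : Fin n → Fin n → Set
  ClosedAdj u v = u ≡ v ⊎ Adj u v

  data Reach : Fin n → Fin n → Set where
    here : ∀ {u} → Reach u u
    step : ∀ {u v w} → Adj u v → Reach v w → Reach u w

  Connected : Set
  Connected = ∀ u v → Reach u v

  InducedP4 : Set
  InducedP4 = Σ (Fin n) λ a → Σ (Fin n) λ b → Σ (Fin n) λ c → Σ (Fin n) λ d →
    (a ≢ b × a ≢ c × a ≢ d × b ≢ c × b ≢ d × c ≢ d) ×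
    (Adj a b × Adj b c × Adj c d) ×
    (NonAdj a c × NonAdj b d × NonAdj a d)

  Cograph : Set
  Cograph = ¬ InducedP4

  Cops : ℕ → Set
  Cops k = Fin k → Fin n

  CopMove : ∀ {k} → Cops k → Cops k → Set
  CopMove C C' = ∀ i → ClosedAdj (C i) (C' i)

  Caught : ∀ {k} → Cops k → Fin n → Set
  Caught C r = ∃ λ i → C i ≡ r

  Dominated : ∀ {k} → Cops k → Fin n → Set
  Dominated C w = ∃ λ i → ClosedAdj (C i) w

  -- robber at r (robber to move) is confined: any move to a neighbour
  -- leads to capture in the next move of the cops
  Confined : ∀ {k} → Cops k → Fin n → Set
  Confined C r = ∀ w → Adj r w → Dominated C w

  -- Positions from which the cops can force capture or confinement.
  -- CopsWinC: cops to move; CopsWinR: robber to move.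
  -- (least fixed point = the cops force it in finitely many rounds)
  data CopsWinC {k : ℕ} : Cops k → Fin n → Set
  data CopsWinR {k : ℕ} : Cops k → Fin n → Set

  data CopsWinC {k} where
    capC : ∀ {C r} → Caught C r → CopsWinC C r
    move : ∀ {C r} C' → CopMove C C' → CopsWinR C' r → CopsWinC C r

  data CopsWinR {k} where
    capR     : ∀ {C r} → Caught C r → CopsWinR C r
    confined : ∀ {C r} → Confined C r → CopsWinR C r
    respond  : ∀ {C r} → (∀ r' → ClosedAdj r r' → CopsWinC C r') → CopsWinR C r

  -- k cops can force confinement (or capture): cops place first, then the
  -- robber places, then the cops move.
  CanConfine : ℕ → Set
  CanConfine k = Σ (Cops k) λ C → ∀ r → CopsWinC C r

  IsCcn : ℕ → Set
  IsCcn k = 1 ≤ k × CanConfine k × (∀ j → 1 ≤ j → j < k → ¬ CanConfine j)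

module Submission where

-- Part 1.  Call v "far" from c if v ∉ N[c].  A single cop posted at c
-- confines the robber as soon as no edge joins two vertices far from c:
-- a robber far from c can only step into N[c].  So it suffices that such a
-- post exists when n < 8.  Suppose instead that every vertex has a far edge.
-- Then the co-ball of every vertex x (the vertices at distance ≤ 2 from x in
-- the complement) contains four distinct vertices.  In a connected cograph
-- any two non-adjacent vertices have a common neighbour, and re-anchoring at
-- such common neighbours produces an edge pq with N[p] ∪ N[q] = V.  The
-- co-balls of p and q are then disjoint, so n ≥ 4 + 4 = 8.
--
-- Part 2.  For n ≥ 8 take the join (K₂ + K₂) ∨ (K₂ + K_{n-6}).  Two cops,
-- one on each side, dominate every vertex.  Against one cop the robber always
-- stays in the clique partnered with the cop's clique, and after every cop
-- move has a neighbour far from the cop, so he is never confined.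

open import Defs
open import Data.Nat using (ℕ; zero; suc; _+_; _≤_; _<_; z≤n; s≤s)
open import Data.Nat.Properties using (<⇒≱; m≤n⇒∃[o]m+o≡n)
open import Data.Fin using (Fin; zero; suc; #_; toℕ; _≟_)
open import Data.Fin.Properties using (any?; ¬∀⟶∃¬; injective⇒≤)
open import Data.Bool using (Bool; true; false; not)
open import Data.Bool.Properties using (not-involutive; not-¬)
import Data.Bool.Properties as Bool
open import Data.Product using (Σ; _×_; _,_; proj₁; proj₂)
open import Data.Product.Properties using (≡-dec)
open import Data.Sum using (_⊎_; inj₁; inj₂)
open import Data.Empty using (⊥; ⊥-elim)
open import Data.List using (List; []; _∷_; allFin)
import Data.List.Relation.Unary.All as ListAll
open import Data.List.Membership.Propositional.Properties using (∈-allFin)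
open import Data.Vec using (Vec; []; _∷_; _++_)
open import Data.Vec.Relation.Unary.All using (All; []; _∷_)
import Data.Vec.Relation.Unary.All as All
open import Data.Vec.Relation.Unary.AllPairs using ([]; _∷_)
import Data.Vec.Relation.Unary.AllPairs.Properties as AllPairs
open import Data.Vec.Relation.Unary.Unique.Propositional using (Unique)
open import Data.Vec.Relation.Unary.Unique.Propositional.Properties using (lookup-injective)
open import Function.Bundles using (mk⇔)
open import Relation.Nullary using (¬_; Dec; yes; no; does; ¬?)
open import Relation.Nullary.Decidable using (_×-dec_; dec-true; dec-false; does-⇔; decidable-stable)
open import Relation.Binary.PropositionalEquality
  using (_≡_; _≢_; refl; sym; trans; cong; subst; module ≡-Reasoning)

from-does : ∀ {A : Set} (a? : Dec A) → does a? ≡ true → A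
from-does (yes a) _ = a
from-does (no _) ()

unique⇒≤ : ∀ {m n} {xs : Vec (Fin n) m} → Unique xs → m ≤ n
unique⇒≤ u = injective⇒≤ (λ {i} {j} → lookup-injective u i j)

unique-++ : ∀ {A : Set} {P Q : A → Set} {k l} {xs : Vec A k} {ys : Vec A l} →
            Unique xs → Unique ys → All P xs → All Q ys →
            (∀ {v} → P v → Q v → ⊥) → Unique (xs ++ ys)
unique-++ {Q = Q} uxs uys pxs qys disjoint =
  AllPairs.++⁺ uxs uys (All.map (λ px → All.map (λ qy eq → disjoint px (subst Q (sym eq) qy)) qys) pxs)

module _ {n : ℕ} (G : Graph n) where
  open Graph G renaming (sym to E-sym)

  adj-sym : ∀ {u v} → Adj G u v → Adj G v u
  adj-sym {u} {v} e = trans (E-sym v u) e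

  nonadj-sym : ∀ {u v} → NonAdj G u v → NonAdj G v u
  nonadj-sym {u} {v} e = trans (E-sym v u) e

  adj-nonadj : ∀ {u v} → Adj G u v → NonAdj G u v → ⊥
  adj-nonadj p q with () ← trans (sym p) q

  adjacency : ∀ u v → Adj G u v ⊎ NonAdj G u v
  adjacency u v with E u v
  ... | true  = inj₁ refl
  ... | false = inj₂ refl

  adj⇒≢ : ∀ {u v} → Adj G u v → u ≢ v
  adj⇒≢ {u} uv refl = adj-nonadj uv (irrefl u)

  Far : Fin n → Fin n → Set
  Far u v = u ≢ v × NonAdj G u v

  far-not-closed : ∀ {u v} → Far u v → ¬ ClosedAdj G u v
  far-not-closed (u≢v , _) (inj₁ u≡v) = u≢v u≡v
  far-not-closed (_ , nuv) (inj₂ uv) = adj-nonadj uv nuv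

  closed-or-far : ∀ u v → ClosedAdj G u v ⊎ Far u v
  closed-or-far u v with u ≟ v | adjacency u v
  ... | yes u≡v | _         = inj₁ (inj₁ u≡v)
  ... | no _    | inj₁ uv   = inj₁ (inj₂ uv)
  ... | no u≢v  | inj₂ nuv  = inj₂ (u≢v , nuv)

  far? : ∀ u v → Dec (Far u v)
  far? u v with closed-or-far u v
  ... | inj₁ near = no (λ far → far-not-closed far near)
  ... | inj₂ far  = yes far

  dominating-set-confines : ∀ {k} (C : Cops G k) → (∀ w → Dominated G C w) → CanConfine G k
  dominating-set-confines C dom = C , λ r → move C (λ _ → inj₁ refl) (confined (λ w _ → dom w))

  FarEdge : Fin n → Set
  FarEdge c = Σ (Fin n) λ r → Σ (Fin n) λ w → Far c r × Adj G r w × Far c w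

  far-edge? : ∀ c → Dec (FarEdge c)
  far-edge? c = any? λ r → any? λ w → far? c r ×-dec (E r w Bool.≟ true) ×-dec far? c w

  -- A cop posted at a vertex without far edges confines the robber: it
  -- captures him if he is in N[c], and otherwise stays and every robber
  -- move leads into N[c].
  lone-cop-confines : ∀ c → ¬ FarEdge c → CanConfine G 1
  lone-cop-confines c no-far-edge = (λ _ → c) , strategy
    where
    strategy : ∀ r → CopsWinC G (λ _ → c) r
    strategy r with closed-or-far c r
    ... | inj₁ (inj₁ refl) = capC (zero , refl)
    ... | inj₁ (inj₂ cr)   = move (λ _ → r) (λ _ → inj₂ cr) (capR (zero , refl))
    ... | inj₂ cr-far      = move (λ _ → c) (λ _ → inj₁ refl) (confined λ w rw → zero , step-into-N[c] w rw)
      where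
      step-into-N[c] : ∀ w → Adj G r w → ClosedAdj G c w
      step-into-N[c] w rw with closed-or-far c w
      ... | inj₁ near   = near
      ... | inj₂ cw-far = ⊥-elim (no-far-edge (r , w , cr-far , rw , cw-far))

  one-cop-evaded : (∀ c → Σ (Fin n) (Far c)) →
                   (∀ {c r c'} → Far c r → ClosedAdj G c c' → Σ (Fin n) λ w → Adj G r w × Far c' w) →
                   ¬ CanConfine G 1
  one-cop-evaded start escape (C , win) = evade-C (proj₂ (start (C zero))) (win _)
    where
    evade-C : ∀ {C r} → Far (C zero) r → ¬ CopsWinC G C r
    evade-R : ∀ {c C' r} → Far c r → ClosedAdj G c (C' zero) → ¬ CopsWinR G C' r
    evade-C far (capC (zero , refl)) = proj₁ far refl
    evade-C far (move C' moved next) = evade-R far (moved zero) next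
    evade-R far cc' (capR (zero , refl)) = far-not-closed far cc'
    evade-R far cc' (confined confinement) with escape far cc'
    ... | w , rw , c'w-far with confinement w rw
    ...   | zero , c'w = far-not-closed c'w-far c'w
    evade-R far cc' (respond next) with escape far cc'
    ... | w , rw , c'w-far = evade-C c'w-far (next w (inj₂ rw))

  CoBall : Fin n → Fin n → Set
  CoBall x v = x ≡ v ⊎ Far x v ⊎ Σ (Fin n) λ z → Far x z × Far z v

  far-vertex-avoiding : ∀ {r} → FarEdge r → ∀ x → Σ (Fin n) λ u → Far r u × x ≢ u
  far-vertex-avoiding (s , t , rs , st , rt) x with x ≟ s
  ... | yes refl = t , rt , adj⇒≢ st
  ... | no x≢s   = s , rs , x≢s

  -- If every vertex has a far edge, every co-ball has four distinct
  -- vertices: x, a far edge rw at x, and a far vertex u of r.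
  four-in-coball : (∀ c → FarEdge c) → ∀ x → Σ (Vec (Fin n) 4) λ vs → Unique vs × All (CoBall x) vs
  four-in-coball far-edge x with far-edge x
  ... | r , w , (x≢r , xr) , rw , (x≢w , xw) with far-vertex-avoiding (far-edge r) x
  ...   | u , (r≢u , ru) , x≢u =
    x ∷ r ∷ w ∷ u ∷ [] ,
    (x≢r ∷ x≢w ∷ x≢u ∷ []) ∷ (adj⇒≢ rw ∷ r≢u ∷ []) ∷ (w≢u ∷ []) ∷ [] ∷ [] ,
    inj₁ refl ∷ inj₂ (inj₁ (x≢r , xr)) ∷ inj₂ (inj₁ (x≢w , xw)) ∷ inj₂ (inj₂ (r , (x≢r , xr) , (r≢u , ru))) ∷ []
    where
    w≢u : w ≢ u
    w≢u refl = adj-nonadj rw ru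

  module _ (cograph : Cograph G) where

    no-P4 : ∀ {a b c d} → Adj G a b → Adj G b c → Adj G c d →
            NonAdj G a c → NonAdj G b d → NonAdj G a d → ⊥
    no-P4 {a} {b} {c} {d} ab bc cd ac bd ad =
      cograph (a , b , c , d , (adj⇒≢ ab , a≢c , a≢d , adj⇒≢ bc , b≢d , adj⇒≢ cd) , (ab , bc , cd) , (ac , bd , ad))
      where
      a≢c : a ≢ c
      a≢c refl = adj-nonadj cd ad
      a≢d : a ≢ d
      a≢d refl = adj-nonadj (adj-sym cd) ac
      b≢d : b ≢ d
      b≢d refl = adj-nonadj ab ad

    -- Walks in a cograph shorten to length at most 2: a walk u x y v of
    -- length 3 without any shortcut is an induced P4.
    within-two : ∀ {u v} → Reach G u v → ClosedAdj G u v ⊎ Σ (Fin n) λ y → Adj G u y × Adj G y v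
    within-two here = inj₁ (inj₁ refl)
    within-two (step {u} {x} {v} ux rest) with within-two rest
    ... | inj₁ (inj₁ refl) = inj₁ (inj₂ ux)
    ... | inj₁ (inj₂ xv) = inj₂ (x , ux , xv)
    ... | inj₂ (y , xy , yv) with adjacency u y | adjacency x v | adjacency u v
    ...   | inj₁ uy | _       | _       = inj₂ (y , uy , yv)
    ...   | inj₂ _  | inj₁ xv | _       = inj₂ (x , ux , xv)
    ...   | inj₂ _  | inj₂ _  | inj₁ uv = inj₁ (inj₂ uv)
    ...   | inj₂ uy | inj₂ xv | inj₂ uv = ⊥-elim (no-P4 ux xy yv uy xv uv)

    common-neighbour : Connected G → ∀ {u v} → Far u v → Σ (Fin n) λ y → Adj G u y × Adj G y v
    common-neighbour connected {u} {v} far with within-two (connected u v)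
    ... | inj₁ near = ⊥-elim (far-not-closed far near)
    ... | inj₂ path = path

    Dominating : Fin n → Fin n → Set
    Dominating p q = ∀ v → ¬ (Far p v × Far q v)

    re-anchor : ∀ {c y y' v} → Adj G c y → Adj G c y' → Adj G y' v → Far c v → Far y v →
                ∀ {u} → Far c u → Far y' u → Far y u
    re-anchor {c} {y} {y'} {v} cy cy' y'v (_ , cv) (_ , yv) {u} (_ , cu) (_ , y'u) = y≢u , yu
      where
      y≢u : y ≢ u
      y≢u refl = adj-nonadj cy cu
      yu : NonAdj G y u
      yu with adjacency y u | adjacency y y' | adjacency u v
      ... | inj₂ nyu | _        | _       = nyu
      ... | inj₁ _   | inj₂ nyy' | _       = ⊥-elim (no-P4 (adj-sym cy) cy' y'v nyy' cv yv)
      ... | inj₁ _   | inj₁ _    | inj₁ uv = ⊥-elim (no-P4 uv (adj-sym y'v) (adj-sym cy') (nonadj-sym y'u) (nonadj-sym cv) (nonadj-sym cu))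
      ... | inj₁ yu' | inj₁ yy'  | inj₂ nuv = ⊥-elim (no-P4 (adj-sym yu') yy' y'v (nonadj-sym y'u) yv nuv)

    -- Re-anchoring vertex by vertex dominates any given list of vertices.
    dominate-list : Connected G → ∀ {c} (vs : List (Fin n)) {y} → Adj G c y →
                    Σ (Fin n) λ y' → Adj G c y' × ListAll.All (λ v → ¬ (Far c v × Far y' v)) vs
    dominate-list connected [] {y} cy = y , cy , ListAll.[]
    dominate-list connected {c} (v ∷ vs) cy with dominate-list connected vs cy
    ... | y , cy , dominated with far? c v ×-dec far? y v
    ...   | no v-dominated = y , cy , v-dominated ListAll.∷ dominated
    ...   | yes (cv , yv) with common-neighbour connected cv
    ...     | y' , cy' , y'v =
      y' , cy' , (λ (_ , y'v-far) → far-not-closed y'v-far (inj₂ y'v)) ListAll.∷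
                 ListAll.map (λ ¬both (cu , y'u) → ¬both (cu , re-anchor cy cy' y'v cv yv cu y'u)) dominated

    dominating-edge : Connected G → ∀ {c y} → Adj G c y → Σ (Fin n) λ y' → Adj G c y' × Dominating c y'
    dominating-edge connected cy with dominate-list connected (allFin n) cy
    ... | y' , cy' , dominated = y' , cy' , λ v → ListAll.lookup dominated (∈-allFin v)

    -- Across a dominating edge pq, every vertex far from p is adjacent to q ...
    far-adjacent : ∀ {p q v} → Adj G p q → Dominating p q → Far p v → Adj G q v
    far-adjacent {q = q} {v} pq dom pv with closed-or-far q v
    ... | inj₁ (inj₁ refl) = ⊥-elim (far-not-closed pv (inj₂ pq))
    ... | inj₁ (inj₂ qv)   = qv
    ... | inj₂ qv          = ⊥-elim (dom v (pv , qv))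

    -- ... and so is the whole co-ball of p: a vertex v far from a far vertex
    -- z of p but not adjacent to q would either be far from both p and q, or
    -- close the induced path v p q z.
    coball-adjacent : ∀ {p q} → Adj G p q → Dominating p q → ∀ {v} → CoBall p v → Adj G q v
    coball-adjacent pq dom (inj₁ refl) = adj-sym pq
    coball-adjacent pq dom (inj₂ (inj₁ pv)) = far-adjacent pq dom pv
    coball-adjacent {p} {q} pq dom {v} (inj₂ (inj₂ (z , pz , zv))) with adjacency q v
    ... | inj₁ qv = qv
    ... | inj₂ nqv with adjacency p v
    ...   | inj₁ pv  = ⊥-elim (no-P4 (adj-sym pv) pq (far-adjacent pq dom pz)
                                     (nonadj-sym nqv) (proj₂ pz) (nonadj-sym (proj₂ zv)))
    ...   | inj₂ npv = far-adjacent pq dom (p≢v , npv)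
      where
      p≢v : p ≢ v
      p≢v refl = adj-nonadj (adj-sym pq) nqv

    coball-via-far : ∀ {x g} → Adj G x g → CoBall x g → Σ (Fin n) λ z → Far x z × Far z g
    coball-via-far xg (inj₁ refl) = ⊥-elim (adj⇒≢ xg refl)
    coball-via-far xg (inj₂ (inj₁ xg-far)) = ⊥-elim (far-not-closed xg-far (inj₂ xg))
    coball-via-far xg (inj₂ (inj₂ via)) = via

    dominating-sym : ∀ {p q} → Dominating p q → Dominating q p
    dominating-sym dom v (qv , pv) = dom v (pv , qv)

    -- The two ends of a dominating edge have disjoint co-balls: a common
    -- member g is adjacent to both ends, so it is reached through far
    -- vertices z₁ of p and z₂ of q, and both ways z₁, z₂ can be related
    -- yield an induced P4.
    coballs-disjoint : ∀ {p q} → Adj G p q → Dominating p q → ∀ {g} → CoBall p g → CoBall q g → ⊥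
    coballs-disjoint {p} {q} pq dom {g} bp bq = meet (coball-via-far pg bp) (coball-via-far qg bq)
      where
      pg : Adj G p g
      pg = coball-adjacent (adj-sym pq) (dominating-sym dom) bq
      qg : Adj G q g
      qg = coball-adjacent pq dom bp
      q-sees : ∀ {z} → Far p z → Adj G q z
      q-sees = far-adjacent pq dom
      p-sees : ∀ {z} → Far q z → Adj G p z
      p-sees = far-adjacent (adj-sym pq) (dominating-sym dom)
      meet : (Σ (Fin n) λ z → Far p z × Far z g) → (Σ (Fin n) λ z → Far q z × Far z g) → ⊥
      meet (z₁ , pz₁ , z₁g) (z₂ , qz₂ , z₂g) with adjacency z₁ z₂
      ... | inj₂ nz₁z₂ =
        no-P4 (adj-sym (q-sees pz₁)) (adj-sym pq) (p-sees qz₂) (nonadj-sym (proj₂ pz₁)) (proj₂ qz₂) nz₁z₂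
      ... | inj₁ z₁z₂ =
        no-P4 (adj-sym pg) (p-sees qz₂) (adj-sym z₁z₂) (nonadj-sym (proj₂ z₂g)) (proj₂ pz₁) (nonadj-sym (proj₂ z₁g))

    -- A connected cograph in which every vertex has a far edge has at least
    -- 8 vertices: the co-balls at the ends of a dominating edge are disjoint
    -- and each contains four distinct vertices.
    eight-vertices : Connected G → Fin n → (∀ c → FarEdge c) → 8 ≤ n
    eight-vertices connected c far-edge with far-edge c
    ... | r , _ , cr , _ with common-neighbour connected cr
    ...   | _ , cy₀ , _ with dominating-edge connected cy₀
    ...     | y , cy , dom with four-in-coball far-edge c | four-in-coball far-edge y
    ...       | _ , unique-c , in-c | _ , unique-y , in-y =
      unique⇒≤ (unique-++ unique-c unique-y in-c in-y (coballs-disjoint cy dom))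

small-cographs-ccn-one : (n : ℕ) → 1 ≤ n → n < 8 → (G : Graph n) → Connected G → Cograph G → IsCcn G 1
small-cographs-ccn-one (suc m) _ n<8 G connected cograph with
  ¬∀⟶∃¬ (suc m) (FarEdge G) (far-edge? G) (λ far-edge → <⇒≱ n<8 (eight-vertices G cograph connected zero far-edge))
... | c , no-far-edge = s≤s z≤n , lone-cop-confines G c no-far-edge , λ { (suc _) _ (s≤s ()) }

-- Part 2: the join (K₂ + K₂) ∨ (K₂ + K_{m+2}) on 8 + m vertices.
-- A clique is named by its side and its half; the vertices of a clique are
-- adjacent to all other vertices except those of the partner clique (same
-- side, other half).
Clique : Set
Clique = Bool × Bool

_≟ᶜ_ : (x y : Clique) → Dec (x ≡ y)
_≟ᶜ_ = ≡-dec Bool._≟_ Bool._≟_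

partner : Clique → Clique
partner (s , h) = s , not h

across : Clique → Clique
across (s , h) = not s , h

partner-involutive : ∀ x → partner (partner x) ≡ x
partner-involutive (s , h) = cong (s ,_) (not-involutive h)

partner-swap : ∀ {x y} → partner x ≡ y → partner y ≡ x
partner-swap {x} refl = partner-involutive x

partner-injective : ∀ {x y} → partner x ≡ partner y → x ≡ y
partner-injective {x} eq = trans (sym (partner-involutive x)) (partner-swap (sym eq))

partner-≢ : ∀ x → partner x ≢ x
partner-≢ (s , h) eq = not-¬ {h} refl (sym (cong proj₂ eq))

sides-differ : ∀ {s h h' : Bool} → (not s , h) ≢ (s , h')
sides-differ {s} eq = not-¬ {s} refl (sym (cong proj₁ eq))

across-≢ : ∀ x → x ≢ across x
across-≢ (s , h) eq = sides-differ (sym eq)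

across-≢-partner : ∀ x → across x ≢ partner x
across-≢-partner (s , h) = sides-differ

partner-≢-partner-across : ∀ x → partner x ≢ partner (across x)
partner-≢-partner-across (s , h) eq = sides-differ (sym eq)

module Example (m : ℕ) where
  N : ℕ
  N = 8 + m

  clique-of-index : ℕ → Clique
  clique-of-index 0 = false , false
  clique-of-index 1 = false , false
  clique-of-index 2 = false , true
  clique-of-index 3 = false , true
  clique-of-index 4 = true , false
  clique-of-index 5 = true , false
  clique-of-index _ = true , true

  clique : Fin N → Clique
  clique v = clique-of-index (toℕ v)

  first second : Clique → Fin N
  first (false , false) = # 0
  first (false , true)  = # 2
  first (true , false)  = # 4
  first (true , true)   = # 6
  second (false , false) = # 1
  second (false , true)  = # 3
  second (true , false)  = # 5
  second (true , true)   = # 7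

  clique-first : ∀ x → clique (first x) ≡ x
  clique-first (false , false) = refl
  clique-first (false , true)  = refl
  clique-first (true , false)  = refl
  clique-first (true , true)   = refl

  clique-second : ∀ x → clique (second x) ≡ x
  clique-second (false , false) = refl
  clique-second (false , true)  = refl
  clique-second (true , false)  = refl
  clique-second (true , true)   = refl

  first≢second : ∀ x → first x ≢ second x
  first≢second (false , false) ()
  first≢second (false , true)  ()
  first≢second (true , false)  ()
  first≢second (true , true)   ()

  another : ∀ r → Σ (Fin N) λ w → clique w ≡ clique r × r ≢ w
  another r with r ≟ first (clique r)
  ... | yes r≡first = second (clique r) , clique-second _ , λ r≡second → first≢second (clique r) (trans (sym r≡first) r≡second)
  ... | no r≢first  = first (clique r) , clique-first _ , r≢first

  Linked : Fin N → Fin N → Set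
  Linked u v = u ≢ v × clique v ≢ partner (clique u)

  linked? : ∀ u v → Dec (Linked u v)
  linked? u v = ¬? (u ≟ v) ×-dec ¬? (clique v ≟ᶜ partner (clique u))

  linked-sym : ∀ {u v} → Linked u v → Linked v u
  linked-sym (u≢v , np) = (λ v≡u → u≢v (sym v≡u)) , λ eq → np (sym (partner-swap (sym eq)))

  graph : Graph N
  graph = record
    { E      = λ u v → does (linked? u v)
    ; sym    = λ u v → does-⇔ (mk⇔ linked-sym linked-sym) (linked? u v) (linked? v u)
    ; irrefl = λ u → dec-false (linked? u u) (λ (u≢u , _) → u≢u refl)
    }

  adjacent : ∀ {u v} → u ≢ v → clique v ≢ partner (clique u) → Adj graph u v
  adjacent {u} {v} u≢v np = dec-true (linked? u v) (u≢v , np)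

  adjacent-cliques : ∀ {u v x y} → clique u ≡ x → clique v ≡ y → x ≢ y → y ≢ partner x → Adj graph u v
  adjacent-cliques {u} {v} refl refl x≢y = adjacent {u} {v} (λ { refl → x≢y refl })

  adjacent⇒not-partner : ∀ {u v} → Adj graph u v → clique v ≢ partner (clique u)
  adjacent⇒not-partner {u} {v} uv = proj₂ (from-does (linked? u v) uv)

  far⇒partner : ∀ {u v} → Far graph u v → clique v ≡ partner (clique u)
  far⇒partner {u} {v} (u≢v , nuv) =
    decidable-stable (clique v ≟ᶜ partner (clique u))
      (λ np → adj-nonadj graph {u} {v} (adjacent u≢v np) nuv)

  partner⇒far : ∀ {u v} → clique v ≡ partner (clique u) → Far graph u v
  partner⇒far {u} {v} eq =
    (λ { refl → partner-≢ (clique u) (sym eq) }) , dec-false (linked? u v) (λ (_ , np) → np eq)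

  closed⇒not-partner : ∀ {u v} → ClosedAdj graph u v → clique v ≢ partner (clique u)
  closed⇒not-partner {u} (inj₁ refl) eq = partner-≢ (clique u) (sym eq)
  closed⇒not-partner {u} {v} (inj₂ uv) = adjacent⇒not-partner {u} {v} uv

  not-partner⇒closed : ∀ {u v} → clique v ≢ partner (clique u) → ClosedAdj graph u v
  not-partner⇒closed {u} {v} np with closed-or-far graph u v
  ... | inj₁ near = near
  ... | inj₂ far  = ⊥-elim (np (far⇒partner {u} {v} far))

  -- Non-adjacencies a≁c, a≁d, b≁d put c and d in the partner clique of both
  -- a and b, so b ≁ c: the graph has no induced P4.
  is-cograph : Cograph graph
  is-cograph (a , b , c , d , (_ , a≢c , a≢d , _ , b≢d , _) , (_ , bc , _) , (ac , bd , ad)) =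
    adjacent⇒not-partner {b} {c} bc (begin
      clique c           ≡⟨ far⇒partner {a} {c} (a≢c , ac) ⟩
      partner (clique a) ≡⟨ sym (far⇒partner {a} {d} (a≢d , ad)) ⟩
      clique d           ≡⟨ far⇒partner {b} {d} (b≢d , bd) ⟩
      partner (clique b) ∎)
    where open ≡-Reasoning

  -- Vertices far apart lie in partner cliques, and any vertex on the other
  -- side is adjacent to both.
  is-connected : Connected graph
  is-connected u v with closed-or-far graph u v
  ... | inj₁ (inj₁ refl) = here
  ... | inj₁ (inj₂ uv)   = step uv here
  ... | inj₂ far =
    step (adjacent-cliques {u} {hub} refl (clique-first _) (across-≢ x) (across-≢-partner x))
         (step (adjacent-cliques {hub} {v} (clique-first _) (far⇒partner {u} {v} far)
                                 (across-≢-partner x) (partner-≢-partner-across x))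
               here)
    where
    x = clique u
    hub = first (across x)

  -- Cops in cliques (false , false) and (true , false): each dominates all
  -- vertices outside its partner clique, and these partners differ.
  two-cops : Cops graph 2
  two-cops zero       = first (false , false)
  two-cops (suc zero) = first (true , false)

  two-cops-dominate : ∀ w → Dominated graph two-cops w
  two-cops-dominate w with clique w ≟ᶜ (false , true)
  ... | yes in-partner-of-first =
    suc zero , not-partner⇒closed {first (true , false)} {w} (λ eq → sides-differ (trans (sym eq) in-partner-of-first))
  ... | no not-in-partner-of-first = zero , not-partner⇒closed {first (false , false)} {w} not-in-partner-of-first

  -- Against one cop the robber starts in the partner clique of the cop ...
  robber-start : ∀ c → Σ (Fin N) (Far graph c)
  robber-start c = first (partner (clique c)) , partner⇒far {c} (clique-first _)

  -- ... and after each cop move to c' escapes to the partner clique of c':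
  -- inside his own clique if that is already it, directly otherwise.
  robber-escape : ∀ {c r c'} → Far graph c r → ClosedAdj graph c c' →
                  Σ (Fin N) λ w → Adj graph r w × Far graph c' w
  robber-escape {c} {r} {c'} far cc' with clique c' ≟ᶜ partner (clique r)
  ... | yes c'-partners-r with another r
  ...   | w , same , r≢w =
    w , adjacent {r} {w} r≢w (λ eq → partner-≢ (clique r) (trans (sym eq) same)) ,
    partner⇒far {c'} {w} (trans same (sym (partner-swap (sym c'-partners-r))))
  robber-escape {c} {r} {c'} far cc' | no c'-not-partners-r =
    first (partner (clique c')) ,
    adjacent-cliques {r} refl (clique-first _)
      (λ eq → c'-not-partners-r (sym (partner-swap (sym eq))))
      (λ eq → different-cliques (partner-injective eq)) ,
    partner⇒far {c'} (clique-first _)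
    where
    different-cliques : clique c' ≢ clique r
    different-cliques eq = closed⇒not-partner {c} {c'} cc' (trans eq (far⇒partner {c} {r} far))

large-cographs-ccn-two : (n : ℕ) → 8 ≤ n → Σ (Graph n) λ G → Connected G × Cograph G × IsCcn G 2
large-cographs-ccn-two n 8≤n with m≤n⇒∃[o]m+o≡n 8≤n
... | m , refl =
  graph , is-connected , is-cograph ,
  s≤s z≤n , dominating-set-confines graph two-cops two-cops-dominate , one-cop-not-enough
  where
  open Example m
  one-cop-not-enough : ∀ j → 1 ≤ j → j < 2 → ¬ CanConfine graph j
  one-cop-not-enough (suc zero)    _ _ = one-cop-evaded graph robber-start robber-escape
  one-cop-not-enough (suc (suc _)) _ (s≤s (s≤s ()))

theorem3p5 : ((n : ℕ) → 1 ≤ n → n < 8 → (G : Graph n) → Connected G → Cograph G → IsCcn G 1)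
    × ((n : ℕ) → 8 ≤ n → Σ (Graph n) λ G → Connected G × Cograph G × IsCcn G 2)
theorem3p5 = small-cographs-ccn-one , large-cographs-ccn-two
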